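{- For every $\lambda\in(0,1)$, standard (respectively, degree-weighted) Lambda-Louvain either places all nodes in one cluster, or produces clusters $S$ each of which has scaled sparsest cut $\mathrm{cut}(S)/(|S||\bar S|)$ (respectively, scaled normalized cut $\mathrm{cut}(S)/(\mathrm{vol}(S)\mathrm{vol}(\bar S))$) bounded above by $\lambda$. The same holds true for GrowCluster.
   Context: Let $G=(V,E)$ be an undirected, unweighted graph, $d_v$ the degree of $v$, $\mathrm{vol}(S)=\sum_{v\in S}d_v$, $\bar S = V\setminus S$, and for disjoint $S,T$, $\mathrm{cut}(S,T)$ the number of edges between $S$ and $T$, with $\mathrm{cut}(S)=\mathrm{cut}(S,\bar S)$. The LambdaCC objective with node weights $w_v$ and parameter $\lambda$ is to minimize, over clusterings with binary distances $x_{ij}$, $\sum_{(i,j)\in E}(1-\lambda w_iw_j)x_{ij} + \sum_{(i,j)\notin E}\lambda w_iw_j(1-x_{ij})$; "standard" uses $w_v=1$ and "degree-weighted" uses $w_v=d_v$. Lambda-Louvain is the Louvain method (iteratively moving nodes to adjacent clusters when that gives a locally best improvement, then aggregating clusters into super-nodes and repeating) adapted to greedily improve the LambdaCC objective instead of modularity; at termination no merge of two clusters improves the objective. GrowCluster repeatedly picks a uniformly random unclustered node $u$, sets $S=\{u\}$, and greedily adds the unclustered node $v$ maximizing $\Delta_v=\mathrm{cut}(S,\{v\})-\lambda|S|$ (standard) or $\Delta_v=\mathrm{cut}(S,\{v\})-\lambda w_v\mathrm{vol}(S)$ (degree-weighted) while this maximum is positive; then $S$ is output as a cluster and removed, and the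 process repeats until all nodes are clustered.
   Formalization: The parameter λ takes only rational values in (0,1). -}

module Defs where

open import Data.Bool using (Bool; true; false; if_then_else_; _∧_; not)
open import Data.Nat as ℕ using (ℕ; zero; suc)
open import Data.Fin using (Fin; zero; suc; toℕ)
open import Data.Fin.Properties using (_≟_)
open import Data.Integer using (+_)
open import Data.Rational using (ℚ; 0ℚ; 1ℚ; _+_; _-_; _*_; _≤_; _<_; _/_)
open import Data.Product using (Σ; _×_; ∃; ∃-syntax)
open import Data.List using (List; []; _∷_)
open import Relation.Nullary using (¬_)
open import Relation.Nullary.Decidable using (⌊_⌋)
open import Relation.Binary.PropositionalEquality using (_≡_)

record Graph (n : ℕ) : Set where
  field
    adj   : Fin n → Fin n → Bool
    sym   : ∀ u v → adj u v ≡ adj v u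
    irref : ∀ v → adj v v ≡ false
open Graph public

ℕ→ℚ : ℕ → ℚ
ℕ→ℚ k = + k / 1

[_]ᵇ : Bool → ℕ
[ true ]ᵇ = 1
[ false ]ᵇ = 0

∑ℕ : ∀ {n} → (Fin n → ℕ) → ℕ
∑ℕ {zero} f = 0
∑ℕ {suc n} f = f zero ℕ.+ ∑ℕ (λ i → f (suc i))

∑ℚ : ∀ {n} → (Fin n → ℚ) → ℚ
∑ℚ {zero} f = 0ℚ
∑ℚ {suc n} f = f zero + ∑ℚ (λ i → f (suc i))

VSet : ℕ → Set
VSet n = Fin n → Bool

module _ {n : ℕ} (G : Graph n) where

  deg : Fin n → ℕ
  deg v = ∑ℕ (λ u → [ adj G v u ]ᵇ)

  size : VSet n → ℕ
  size S = ∑ℕ (λ v → [ S v ]ᵇ)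

  vol : VSet n → ℕ
  vol S = ∑ℕ (λ v → if S v then deg v else 0)

  compl : VSet n → VSet n
  compl S v = not (S v)

  -- cut(S,T): number of edges between S and T (S, T disjoint in use)
  cutBetween : VSet n → VSet n → ℕ
  cutBetween S T = ∑ℕ (λ u → ∑ℕ (λ v → [ S u ∧ T v ∧ adj G u v ]ᵇ))

  cut : VSet n → ℕ
  cut S = cutBetween S (compl S)

data Variant : Set where
  standard degreeWeighted : Variant

module _ {n : ℕ} (G : Graph n) where

  weight : Variant → Fin n → ℕ
  weight standard v = 1
  weight degreeWeighted v = deg G v

  single : Fin n → VSet n
  single v u = ⌊ u ≟ v ⌋

  Clustering : Set
  Clustering = Fin n → Fin n

  sameᵇ : Clustering → Fin n → Fin n → Bool
  sameᵇ c i j = ⌊ c i ≟ c j ⌋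

  clusterOf : Clustering → Fin n → VSet n
  clusterOf c u v = sameᵇ c u v

  objective : ℚ → Variant → Clustering → ℚ
  objective λ′ var c =
    ∑ℚ (λ i → ∑ℚ (λ j →
      if ⌊ toℕ i ℕ.<? toℕ j ⌋
      then (let ww = λ′ * ℕ→ℚ (weight var i ℕ.* weight var j) in
            if adj G i j
            then (if sameᵇ c i j then 0ℚ else 1ℚ - ww)
            else (if sameᵇ c i j then ww else 0ℚ))
      else 0ℚ))

  -- Lambda-Louvain, modelled as a nondeterministic transition system.
  -- State: P = super-node label of each node (current aggregation level),
  --        C = cluster label of each node (coarser than P).
  record LState : Set where
    constructor lstate
    field
      P : Clustering
      C : Clustering
  open LState public

  moveTo : LState → Fin n → Fin n → Clustering
  moveTo s b ℓ v = if ⌊ P s v ≟ b ⌋ then ℓ else C s v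

  AdjTarget : LState → Fin n → Fin n → Set
  AdjTarget s b ℓ = ∃[ v ] ∃[ u ]
    (P s v ≡ b × C s u ≡ ℓ × ¬ (C s v ≡ ℓ) × adj G v u ≡ true)

  Improving : ℚ → Variant → LState → Fin n → Fin n → Set
  Improving λ′ var s b ℓ = objective λ′ var (moveTo s b ℓ) < objective λ′ var (C s)

  data LMove (λ′ : ℚ) (var : Variant) (s : LState) : LState → Set where
    move : ∀ b ℓ → AdjTarget s b ℓ → Improving λ′ var s b ℓ →
           (∀ ℓ′ → AdjTarget s b ℓ′ →
              objective λ′ var (moveTo s b ℓ) ≤ objective λ′ var (moveTo s b ℓ′)) →
           LMove λ′ var s (lstate (P s) (moveTo s b ℓ))

  Stable : ℚ → Variant → LState → Set
  Stable λ′ var s = ∀ b ℓ → AdjTarget s b ℓ → ¬ Improving λ′ var s b ℓ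

  -- clusters coincide with super-nodes (aggregation would change nothing)
  SamePartition : LState → Set
  SamePartition s = ∀ u v → C s u ≡ C s v → P s u ≡ P s v

  data LRun (λ′ : ℚ) (var : Variant) : LState → Clustering → Set where
    step      : ∀ {s s′ c} → LMove λ′ var s s′ → LRun λ′ var s′ c → LRun λ′ var s c
    aggregate : ∀ {s c} → Stable λ′ var s → ¬ SamePartition s →
                LRun λ′ var (lstate (C s) (C s)) c → LRun λ′ var s c
    stop      : ∀ {s} → Stable λ′ var s → SamePartition s → LRun λ′ var s (C s)

  LambdaLouvainOutput : ℚ → Variant → Clustering → Set
  LambdaLouvainOutput λ′ var c = LRun λ′ var (lstate (λ v → v) (λ v → v)) c

  -- GrowCluster, modelled as a nondeterministic process
  -- (any choice of the random seed node, any tie-breaking).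

  gain : ℚ → Variant → VSet n → Fin n → ℚ
  gain λ′ standard S v = ℕ→ℚ (cutBetween G S (single v)) - λ′ * ℕ→ℚ (size G S)
  gain λ′ degreeWeighted S v =
    ℕ→ℚ (cutBetween G S (single v)) - λ′ * ℕ→ℚ (weight degreeWeighted v ℕ.* vol G S)

  Cand : VSet n → VSet n → Fin n → Set
  Cand U S v = U v ≡ true × S v ≡ false

  insert : Fin n → VSet n → VSet n
  insert v S u = S u Data.Bool.∨ ⌊ u ≟ v ⌋

  data Grow (λ′ : ℚ) (var : Variant) (U : VSet n) : VSet n → VSet n → Set where
    add  : ∀ {S out} v → Cand U S v → 0ℚ < gain λ′ var S v →
           (∀ v′ → Cand U S v′ → gain λ′ var S v′ ≤ gain λ′ var S v) →
           Grow λ′ var U (insert v S) out → Grow λ′ var U S out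
    done : ∀ {S} → (∀ v → Cand U S v → gain λ′ var S v ≤ 0ℚ) → Grow λ′ var U S S

  minus : VSet n → VSet n → VSet n
  minus U S v = U v ∧ not (S v)

  data GC (λ′ : ℚ) (var : Variant) : VSet n → List (VSet n) → Set where
    finish : ∀ {U} → (∀ v → U v ≡ false) → GC λ′ var U []
    next   : ∀ {U S cs} u → U u ≡ true → Grow λ′ var U (single u) S →
             GC λ′ var (minus U S) cs → GC λ′ var U (S ∷ cs)

  GrowClusterOutput : ℚ → Variant → List (VSet n) → Set
  GrowClusterOutput λ′ var cs = GC λ′ var (λ _ → true) cs

  -- The bound: scaled sparsest cut (standard) / scaled normalized cut
  -- (degree-weighted) of S is at most λ, written with the denominator
  -- multiplied out: cut(S) ≤ λ |S||S̄|  resp.  cut(S) ≤ λ vol(S) vol(S̄).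
  ScaledCutBound : ℚ → Variant → VSet n → Set
  ScaledCutBound λ′ standard S =
    ℕ→ℚ (cut G S) ≤ λ′ * ℕ→ℚ (size G S ℕ.* size G (compl G S))
  ScaledCutBound λ′ degreeWeighted S =
    ℕ→ℚ (cut G S) ≤ λ′ * ℕ→ℚ (vol G S ℕ.* vol G (compl G S))

module Submission where

-- Both algorithms stop in a locally unimprovable state, and local
-- optimality bounds the cut of each cluster S by λ·W(S)·W(S̄), where
-- W(X) = Σ_{v∈X} w_v is |X| (standard) or vol(X) (degree-weighted).
-- The bound is assembled from pieces: if S̄ is partitioned into T₁,…,T_m
-- with cut(S,Tₖ) ≤ λ·W(S)·W(Tₖ) for all k, summing gives the bound
-- (`bound-from-partition`).
--  * Lambda-Louvain: merging clusters S and T lowers the objective by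
--    exactly cut(S,T) − λ·W(S)·W(T) (`objective-merge`).  At termination
--    clusters are super-nodes, so merging S into an adjacent cluster is an
--    allowed move; stability says it does not improve, giving the piece
--    bounds with the other clusters as pieces.
--  * GrowCluster: when the growth of S stops, every unclustered v ∉ S has
--    gain Δ_v ≤ 0, i.e. cut(S,{v}) ≤ λ·w_v·W(S); summing such node bounds
--    (`bound-from-nodes`) bounds cut(S, U∖S).  The invariant that every
--    unclustered node satisfies this bound against the already clustered
--    nodes Ū bounds cut(S, Ū).  The
-- bound also holds for S = V (then S̄ = ∅), so the theorem always holds
-- with its second alternative.

open import Defs hiding (sym)
open import Data.Nat as ℕ using (ℕ; zero; suc)
import Data.Nat.Properties as ℕP
import Data.Integer as ℤ
import Data.Integer.Properties as ℤP
open import Data.Rational as ℚ using (ℚ; 0ℚ; 1ℚ; _+_; _*_; _-_; -_; _≤_; _<_; toℚᵘ)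
import Data.Rational.Properties as ℚP
import Data.Rational.Unnormalised as ℚᵘ
import Data.Rational.Unnormalised.Properties as ℚᵘP
open import Data.Fin using (Fin; zero; suc; toℕ)
open import Data.Fin.Properties as Fin using (_≟_; toℕ-injective)
open import Data.Bool using (Bool; true; false; _∧_; _∨_; not; if_then_else_)
open import Data.Bool.Properties using (T-≡; ∧-conicalˡ; ∧-conicalʳ; not-injective)
open import Data.Product using (_×_; _,_; proj₁; proj₂; Σ; ∃-syntax)
open import Data.Sum using (_⊎_; inj₁; inj₂)
open import Data.List using (List)
open import Data.List.Relation.Unary.All as All using (All; []; _∷_)
open import Data.List.Relation.Unary.Any using (Any)
open import Data.Empty using (⊥-elim)
open import Function using (_∘_; Equivalence; mk⇔)
open import Relation.Nullary using (¬_; Dec; yes; no; contradiction)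
open import Relation.Nullary.Decidable using (⌊_⌋; ⌊⌋-map′; isYes≗does; dec-true; dec-false; does-⇔; toWitness; decidable-stable)
open import Relation.Binary.PropositionalEquality
open import Relation.Binary.Definitions using (tri<; tri≈; tri>)
open import Algebra.Bundles using (Ring)
import Algebra.Properties.Semiring.Sum as SemiringSum

-- ℕ→ℚ k is the fraction k/1; additivity is checked on the unnormalised
-- literal k/1, where addition is computed componentwise.
toℚᵘ-ℕ→ℚ : ∀ k → toℚᵘ (ℕ→ℚ k) ℚᵘ.≃ ℚᵘ.mkℚᵘ (ℤ.+ k) 0
toℚᵘ-ℕ→ℚ k = ℚP.toℚᵘ-fromℚᵘ (ℚᵘ.mkℚᵘ (ℤ.+ k) 0)

ℕ→ℚ-+ : ∀ a b → ℕ→ℚ (a ℕ.+ b) ≡ ℕ→ℚ a + ℕ→ℚ b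
ℕ→ℚ-+ a b = ℚP.toℚᵘ-injective (begin
  toℚᵘ (ℕ→ℚ (a ℕ.+ b))                  ≈⟨ toℚᵘ-ℕ→ℚ (a ℕ.+ b) ⟩
  ℚᵘ.mkℚᵘ (ℤ.+ (a ℕ.+ b)) 0           ≈⟨ ℚᵘ.*≡* (cong (ℤ._* ℤ.1ℤ) literal) ⟩
  ℚᵘ.mkℚᵘ (ℤ.+ a) 0 ℚᵘ.+ ℚᵘ.mkℚᵘ (ℤ.+ b) 0
                                        ≈⟨ ℚᵘP.+-cong (toℚᵘ-ℕ→ℚ a) (toℚᵘ-ℕ→ℚ b) ⟨
  toℚᵘ (ℕ→ℚ a) ℚᵘ.+ toℚᵘ (ℕ→ℚ b)        ≈⟨ ℚP.toℚᵘ-homo-+ (ℕ→ℚ a) (ℕ→ℚ b) ⟨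
  toℚᵘ (ℕ→ℚ a + ℕ→ℚ b)                  ∎)
  where
  open ℚᵘP.≃-Reasoning
  literal : ℤ.+ (a ℕ.+ b) ≡ ℤ.+ a ℤ.* ℤ.1ℤ ℤ.+ ℤ.+ b ℤ.* ℤ.1ℤ
  literal = trans (ℤP.pos-+ a b) (sym (cong₂ ℤ._+_ (ℤP.*-identityʳ (ℤ.+ a)) (ℤP.*-identityʳ (ℤ.+ b))))

ℕ→ℚ-nonNeg : ∀ k → 0ℚ ≤ ℕ→ℚ k
ℕ→ℚ-nonNeg k = ℚP.nonNegative⁻¹ (ℕ→ℚ k) {{ℚP.normalize-nonNeg k 1}}

scaled-nonNeg : ∀ {λ′} → 0ℚ ≤ λ′ → ∀ k → 0ℚ ≤ λ′ * ℕ→ℚ k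
scaled-nonNeg {λ′} 0≤λ′ k = subst (_≤ λ′ * ℕ→ℚ k) (ℚP.*-zeroʳ λ′)
  (ℚP.*-monoˡ-≤-nonNeg λ′ {{ℚ.nonNegative 0≤λ′}} (ℕ→ℚ-nonNeg k))

sub-pos : ∀ {x y} → y < x → 0ℚ < x - y
sub-pos {x} {y} y<x = subst (_< x - y) (ℚP.+-inverseʳ y) (ℚP.+-monoˡ-< (- y) y<x)

sub-nonpos : ∀ {x y} → x - y ≤ 0ℚ → x ≤ y
sub-nonpos {x} {y} x-y≤0 = subst₂ _≤_ cancel (ℚP.+-identityˡ y) (ℚP.+-monoˡ-≤ y x-y≤0)
  where
  cancel : x - y + y ≡ x
  cancel = trans (ℚP.+-assoc x (- y) y) (trans (cong (x +_) (ℚP.+-inverseˡ y)) (ℚP.+-identityʳ x))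

-- Finite sums: the sums ∑ℕ, ∑ℚ of Defs coincide with the library's sums
-- over a semiring, whose laws are transported here.

module ℕΣ = SemiringSum ℕP.+-*-semiring
module ℚΣ = SemiringSum (Ring.semiring ℚP.+-*-ring)

∑ℕ≡sum : ∀ {n} (f : Fin n → ℕ) → ∑ℕ f ≡ ℕΣ.sum f
∑ℕ≡sum {zero} f = refl
∑ℕ≡sum {suc n} f = cong (f zero ℕ.+_) (∑ℕ≡sum (f ∘ suc))

∑ℚ≡sum : ∀ {n} (f : Fin n → ℚ) → ∑ℚ f ≡ ℚΣ.sum f
∑ℚ≡sum {zero} f = refl
∑ℚ≡sum {suc n} f = cong (f zero +_) (∑ℚ≡sum (f ∘ suc))

∑ℕ-cong : ∀ {n} {f g : Fin n → ℕ} → (∀ i → f i ≡ g i) → ∑ℕ f ≡ ∑ℕ g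
∑ℕ-cong {f = f} {g} f≗g = trans (∑ℕ≡sum f) (trans (ℕΣ.sum-cong-≗ f≗g) (sym (∑ℕ≡sum g)))

∑ℚ-cong : ∀ {n} {f g : Fin n → ℚ} → (∀ i → f i ≡ g i) → ∑ℚ f ≡ ∑ℚ g
∑ℚ-cong {f = f} {g} f≗g = trans (∑ℚ≡sum f) (trans (ℚΣ.sum-cong-≗ f≗g) (sym (∑ℚ≡sum g)))

∑ℕ-zero : ∀ n → ∑ℕ {n} (λ _ → 0) ≡ 0
∑ℕ-zero n = trans (∑ℕ≡sum {n} (λ _ → 0)) (ℕΣ.sum-replicate-zero n)

∑ℕ-+ : ∀ {n} (f g : Fin n → ℕ) → ∑ℕ (λ i → f i ℕ.+ g i) ≡ ∑ℕ f ℕ.+ ∑ℕ g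
∑ℕ-+ f g = trans (∑ℕ≡sum (λ i → f i ℕ.+ g i)) (trans (ℕΣ.∑-distrib-+ f g) (sym (cong₂ ℕ._+_ (∑ℕ≡sum f) (∑ℕ≡sum g))))

∑ℚ-+ : ∀ {n} (f g : Fin n → ℚ) → ∑ℚ (λ i → f i + g i) ≡ ∑ℚ f + ∑ℚ g
∑ℚ-+ f g = trans (∑ℚ≡sum (λ i → f i + g i)) (trans (ℚΣ.∑-distrib-+ f g) (sym (cong₂ _+_ (∑ℚ≡sum f) (∑ℚ≡sum g))))

∑ℕ-*ˡ : ∀ {n} c (f : Fin n → ℕ) → ∑ℕ (λ i → c ℕ.* f i) ≡ c ℕ.* ∑ℕ f
∑ℕ-*ˡ c f = trans (∑ℕ≡sum (λ i → c ℕ.* f i)) (sym (trans (cong (c ℕ.*_) (∑ℕ≡sum f)) (ℕΣ.*-distribˡ-sum c f)))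

∑ℚ-*ˡ : ∀ {n} c (f : Fin n → ℚ) → ∑ℚ (λ i → c * f i) ≡ c * ∑ℚ f
∑ℚ-*ˡ c f = trans (∑ℚ≡sum (λ i → c * f i)) (sym (trans (cong (c *_) (∑ℚ≡sum f)) (ℚΣ.*-distribˡ-sum c f)))

∑ℕ-*ʳ : ∀ {n} c (f : Fin n → ℕ) → ∑ℕ (λ i → f i ℕ.* c) ≡ ∑ℕ f ℕ.* c
∑ℕ-*ʳ c f = trans (∑ℕ≡sum (λ i → f i ℕ.* c)) (sym (trans (cong (ℕ._* c) (∑ℕ≡sum f)) (ℕΣ.*-distribʳ-sum c f)))

∑ℕ-comm : ∀ {n m} (f : Fin n → Fin m → ℕ) → ∑ℕ (λ i → ∑ℕ (f i)) ≡ ∑ℕ (λ j → ∑ℕ (λ i → f i j))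
∑ℕ-comm f = trans (nested f) (trans (ℕΣ.∑-comm f) (sym (nested (λ j i → f i j))))
  where
  nested : ∀ {n m} (g : Fin n → Fin m → ℕ) → ∑ℕ (λ i → ∑ℕ (g i)) ≡ ℕΣ.sum (λ i → ℕΣ.sum (g i))
  nested g = trans (∑ℕ≡sum (λ i → ∑ℕ (g i))) (ℕΣ.sum-cong-≗ (λ i → ∑ℕ≡sum (g i)))

∑ℚ-comm : ∀ {n m} (f : Fin n → Fin m → ℚ) → ∑ℚ (λ i → ∑ℚ (f i)) ≡ ∑ℚ (λ j → ∑ℚ (λ i → f i j))
∑ℚ-comm f = trans (nested f) (trans (ℚΣ.∑-comm f) (sym (nested (λ j i → f i j))))
  where
  nested : ∀ {n m} (g : Fin n → Fin m → ℚ) → ∑ℚ (λ i → ∑ℚ (g i)) ≡ ℚΣ.sum (λ i → ℚΣ.sum (g i))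
  nested g = trans (∑ℚ≡sum (λ i → ∑ℚ (g i))) (ℚΣ.sum-cong-≗ (λ i → ∑ℚ≡sum (g i)))

∑ℕ-nonzero : ∀ {n} (f : Fin n → ℕ) → ¬ ∑ℕ f ≡ 0 → Σ (Fin n) (λ i → ¬ f i ≡ 0)
∑ℕ-nonzero {zero} f ∑≢0 = contradiction refl ∑≢0
∑ℕ-nonzero {suc n} f ∑≢0 with f zero ℕ.≟ 0
... | no f₀≢0 = zero , f₀≢0
... | yes f₀≡0 with ∑ℕ-nonzero (f ∘ suc) (λ rest≡0 → ∑≢0 (cong₂ ℕ._+_ f₀≡0 rest≡0))
...   | i , fᵢ≢0 = suc i , fᵢ≢0

ℕ→ℚ-∑ : ∀ {n} (f : Fin n → ℕ) → ℕ→ℚ (∑ℕ f) ≡ ∑ℚ (ℕ→ℚ ∘ f)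
ℕ→ℚ-∑ {zero} f = refl
ℕ→ℚ-∑ {suc n} f = trans (ℕ→ℚ-+ (f zero) _) (cong (ℕ→ℚ (f zero) +_) (ℕ→ℚ-∑ (f ∘ suc)))

scaled-+ : ∀ λ′ a b c d → ℕ→ℚ a ≤ λ′ * ℕ→ℚ b → ℕ→ℚ c ≤ λ′ * ℕ→ℚ d →
           ℕ→ℚ (a ℕ.+ c) ≤ λ′ * ℕ→ℚ (b ℕ.+ d)
scaled-+ λ′ a b c d a≤b c≤d = subst₂ _≤_ (sym (ℕ→ℚ-+ a c))
  (trans (sym (ℚP.*-distribˡ-+ λ′ (ℕ→ℚ b) (ℕ→ℚ d))) (cong (λ′ *_) (sym (ℕ→ℚ-+ b d))))
  (ℚP.+-mono-≤ a≤b c≤d)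

scaled-sum : ∀ {n} λ′ (f g : Fin n → ℕ) → (∀ i → ℕ→ℚ (f i) ≤ λ′ * ℕ→ℚ (g i)) →
             ℕ→ℚ (∑ℕ f) ≤ λ′ * ℕ→ℚ (∑ℕ g)
scaled-sum {zero} λ′ f g f≤g = ℚP.≤-reflexive (sym (ℚP.*-zeroʳ λ′))
scaled-sum {suc n} λ′ f g f≤g = scaled-+ λ′ (f zero) (g zero) (∑ℕ (f ∘ suc)) (∑ℕ (g ∘ suc))
  (f≤g zero) (scaled-sum λ′ (f ∘ suc) (g ∘ suc) (f≤g ∘ suc))

module _ {p} {A : Set p} (a? : Dec A) where

  yes⇒true : A → ⌊ a? ⌋ ≡ true
  yes⇒true a = trans (isYes≗does a?) (dec-true a? a)

  no⇒false : ¬ A → ⌊ a? ⌋ ≡ false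
  no⇒false ¬a = trans (isYes≗does a?) (dec-false a? ¬a)

  true⇒yes : ⌊ a? ⌋ ≡ true → A
  true⇒yes t = toWitness (Equivalence.from T-≡ t)

  false⇒no : ⌊ a? ⌋ ≡ false → ¬ A
  false⇒no f a = contradiction (trans (sym f) (yes⇒true a)) λ ()

≟-cong : ∀ {m} {a b a′ b′ : Fin m} → (a ≡ b → a′ ≡ b′) → (a′ ≡ b′ → a ≡ b) →
         ⌊ a ≟ b ⌋ ≡ ⌊ a′ ≟ b′ ⌋
≟-cong {a = a} {b} {a′} {b′} to from = trans (isYes≗does (a ≟ b))
  (trans (does-⇔ (mk⇔ to from) (a ≟ b) (a′ ≟ b′)) (sym (isYes≗does (a′ ≟ b′))))

∑ℕ-delta : ∀ {n} (v : Fin n) (f : Fin n → ℕ) → ∑ℕ (λ x → [ ⌊ x ≟ v ⌋ ]ᵇ ℕ.* f x) ≡ f v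
∑ℕ-delta {suc n} zero f =
  trans (cong₂ ℕ._+_ (ℕP.+-identityʳ (f zero)) (∑ℕ-zero n)) (ℕP.+-identityʳ (f zero))
∑ℕ-delta {suc n} (suc v) f =
  trans (∑ℕ-cong (λ x → cong (λ b → [ b ]ᵇ ℕ.* f (suc x)) (⌊⌋-map′ (cong suc) Fin.suc-injective (x ≟ v))))
        (∑ℕ-delta v (f ∘ suc))

module Measures {n : ℕ} (G : Graph n) where

  mass : VSet n → (Fin n → ℕ) → ℕ
  mass X f = ∑ℕ (λ v → [ X v ]ᵇ ℕ.* f v)

  W : Variant → VSet n → ℕ
  W var X = mass X (weight G var)

  size-W : ∀ X → size G X ≡ W standard X
  size-W X = ∑ℕ-cong (λ v → sym (ℕP.*-identityʳ [ X v ]ᵇ))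

  vol-W : ∀ X → vol G X ≡ W degreeWeighted X
  vol-W X = ∑ℕ-cong (λ v → indicator (X v))
    where
    indicator : ∀ {v} b → (if b then deg G v else 0) ≡ [ b ]ᵇ ℕ.* deg G v
    indicator true = sym (ℕP.+-identityʳ _)
    indicator false = refl

  edgesFrom : VSet n → Fin n → ℕ
  edgesFrom A v = ∑ℕ (λ u → [ A u ∧ adj G u v ]ᵇ)

  cut-mass : ∀ A T → cutBetween G A T ≡ mass T (edgesFrom A)
  cut-mass A T = begin
    ∑ℕ (λ u → ∑ℕ (λ v → [ A u ∧ T v ∧ adj G u v ]ᵇ))
      ≡⟨ ∑ℕ-cong (λ u → ∑ℕ-cong (λ v → pull-out (A u) (T v) (adj G u v))) ⟩
    ∑ℕ (λ u → ∑ℕ (λ v → [ T v ]ᵇ ℕ.* [ A u ∧ adj G u v ]ᵇ))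
      ≡⟨ ∑ℕ-comm (λ u v → [ T v ]ᵇ ℕ.* [ A u ∧ adj G u v ]ᵇ) ⟩
    ∑ℕ (λ v → ∑ℕ (λ u → [ T v ]ᵇ ℕ.* [ A u ∧ adj G u v ]ᵇ))
      ≡⟨ ∑ℕ-cong (λ v → ∑ℕ-*ˡ [ T v ]ᵇ (λ u → [ A u ∧ adj G u v ]ᵇ)) ⟩
    mass T (edgesFrom A) ∎
    where
    open ≡-Reasoning
    pull-out : ∀ a t e → [ a ∧ t ∧ e ]ᵇ ≡ [ t ]ᵇ ℕ.* [ a ∧ e ]ᵇ
    pull-out false t e = sym (ℕP.*-zeroʳ [ t ]ᵇ)
    pull-out true false e = refl
    pull-out true true e = sym (ℕP.+-identityʳ _)

  cut-single : ∀ A v → cutBetween G A (single G v) ≡ edgesFrom A v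
  cut-single A v = trans (cut-mass A (single G v)) (∑ℕ-delta v (edgesFrom A))

  cut-sym : ∀ A B → cutBetween G A B ≡ cutBetween G B A
  cut-sym A B = trans (∑ℕ-comm (λ u v → [ A u ∧ B v ∧ adj G u v ]ᵇ))
    (∑ℕ-cong (λ v → ∑ℕ-cong (λ u → edge-sym (A u) (B v) (Graph.sym G u v))))
    where
    edge-sym : ∀ a b {e e′} → e ≡ e′ → [ a ∧ b ∧ e ]ᵇ ≡ [ b ∧ a ∧ e′ ]ᵇ
    edge-sym true true refl = refl
    edge-sym true false refl = refl
    edge-sym false true refl = refl
    edge-sym false false refl = refl

  cut-witness : ∀ A B → ¬ cutBetween G A B ≡ 0 →
    ∃[ x ] ∃[ y ] (A x ≡ true × B y ≡ true × adj G x y ≡ true)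
  cut-witness A B cut≢0 with ∑ℕ-nonzero _ cut≢0
  ... | x , row≢0 with ∑ℕ-nonzero _ row≢0
  ...   | y , entry≢0 = x , y , edge (A x) (B y) (adj G x y) entry≢0
    where
    edge : ∀ a b e → ¬ [ a ∧ b ∧ e ]ᵇ ≡ 0 → a ≡ true × b ≡ true × e ≡ true
    edge true true true _ = refl , refl , refl
    edge true true false ≢0 = contradiction refl ≢0
    edge true false e ≢0 = contradiction refl ≢0
    edge false b e ≢0 = contradiction refl ≢0

  mass-partition : ∀ {m} (T : Fin m → VSet n) X f →
    (∀ v → ∑ℕ (λ k → [ T k v ]ᵇ) ≡ [ X v ]ᵇ) → ∑ℕ (λ k → mass (T k) f) ≡ mass X f
  mass-partition T X f partition = trans (∑ℕ-comm (λ k v → [ T k v ]ᵇ ℕ.* f v))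
    (∑ℕ-cong (λ v → trans (∑ℕ-*ʳ (f v) (λ k → [ T k v ]ᵇ)) (cong (ℕ._* f v) (partition v))))

  mass-split : ∀ X Y Z f → (∀ v → [ X v ]ᵇ ≡ [ Y v ]ᵇ ℕ.+ [ Z v ]ᵇ) →
    mass X f ≡ mass Y f ℕ.+ mass Z f
  mass-split X Y Z f split = trans
    (∑ℕ-cong (λ v → trans (cong (ℕ._* f v) (split v)) (ℕP.*-distribʳ-+ (f v) [ Y v ]ᵇ [ Z v ]ᵇ)))
    (∑ℕ-+ (λ v → [ Y v ]ᵇ ℕ.* f v) (λ v → [ Z v ]ᵇ ℕ.* f v))

scaled-cut-bound : ∀ {n} (G : Graph n) λ′ var S → let open Measures G in
  ℕ→ℚ (cut G S) ≤ λ′ * ℕ→ℚ (W var S ℕ.* W var (compl G S)) → ScaledCutBound G λ′ var S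
scaled-cut-bound G λ′ standard S = subst (λ x → ℕ→ℚ (cut G S) ≤ λ′ * ℕ→ℚ x)
  (sym (cong₂ ℕ._*_ (size-W S) (size-W (compl G S))))
  where open Measures G
scaled-cut-bound G λ′ degreeWeighted S = subst (λ x → ℕ→ℚ (cut G S) ≤ λ′ * ℕ→ℚ x)
  (sym (cong₂ ℕ._*_ (vol-W S) (vol-W (compl G S))))
  where open Measures G

module CutBounds {n : ℕ} (G : Graph n) (λ′ : ℚ) (var : Variant) where
  open Measures G

  ClusterBound : VSet n → Set
  ClusterBound S = ℕ→ℚ (cut G S) ≤ λ′ * ℕ→ℚ (W var S ℕ.* W var (compl G S))

  PieceBound : VSet n → VSet n → Set
  PieceBound A B = ℕ→ℚ (cutBetween G A B) ≤ λ′ * ℕ→ℚ (W var A ℕ.* W var B)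

  -- cut(A,{v}) ≤ λ·w_v·W(A): node v gains nothing by joining A.
  NodeBound : VSet n → Fin n → Set
  NodeBound A v = ℕ→ℚ (cutBetween G A (single G v)) ≤ λ′ * ℕ→ℚ (weight G var v ℕ.* W var A)

  piece-sym : ∀ A B → PieceBound A B → PieceBound B A
  piece-sym A B = subst₂ (λ c w → ℕ→ℚ c ≤ λ′ * ℕ→ℚ w) (cut-sym A B) (ℕP.*-comm (W var A) (W var B))

  bound-from-partition : ∀ {m} S (T : Fin m → VSet n) →
    (∀ v → ∑ℕ (λ k → [ T k v ]ᵇ) ≡ [ not (S v) ]ᵇ) →
    (∀ k → PieceBound S (T k)) → ClusterBound S
  bound-from-partition S T partition pieces =
    subst₂ (λ c w → ℕ→ℚ c ≤ λ′ * ℕ→ℚ w) cuts weights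
      (scaled-sum λ′ (λ k → cutBetween G S (T k)) (λ k → W var S ℕ.* W var (T k)) pieces)
    where
    cuts : ∑ℕ (λ k → cutBetween G S (T k)) ≡ cut G S
    cuts = trans (∑ℕ-cong (λ k → cut-mass S (T k)))
                 (trans (mass-partition T (compl G S) (edgesFrom S) partition) (sym (cut-mass S (compl G S))))
    weights : ∑ℕ (λ k → W var S ℕ.* W var (T k)) ≡ W var S ℕ.* W var (compl G S)
    weights = trans (∑ℕ-*ˡ (W var S) (λ k → W var (T k)))
                    (cong (W var S ℕ.*_) (mass-partition T (compl G S) (weight G var) partition))

  bound-from-nodes : ∀ A B → (∀ v → B v ≡ true → NodeBound A v) → PieceBound A B
  bound-from-nodes A B nodes =
    subst₂ (λ c w → ℕ→ℚ c ≤ λ′ * ℕ→ℚ w) (sym (cut-mass A B)) (∑ℕ-*ˡ (W var A) (λ v → [ B v ]ᵇ ℕ.* weight G var v))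
      (scaled-sum λ′ _ _ term)
    where
    term : ∀ v → ℕ→ℚ ([ B v ]ᵇ ℕ.* edgesFrom A v) ≤ λ′ * ℕ→ℚ (W var A ℕ.* ([ B v ]ᵇ ℕ.* weight G var v))
    term v with B v in v∈B
    ... | true = subst₂ (λ c w → ℕ→ℚ c ≤ λ′ * ℕ→ℚ w)
                   (trans (cut-single A v) (sym (ℕP.+-identityʳ _)))
                   (trans (ℕP.*-comm (weight G var v) (W var A)) (cong (W var A ℕ.*_) (sym (ℕP.+-identityʳ _))))
                   (nodes v v∈B)
    ... | false = subst (λ w → 0ℚ ≤ λ′ * ℕ→ℚ w) (sym (ℕP.*-zeroʳ (W var A)))
                    (ℚP.≤-reflexive (sym (ℚP.*-zeroʳ λ′)))

  node-bound-union : ∀ X Y Z v → (∀ u → [ X u ]ᵇ ≡ [ Y u ]ᵇ ℕ.+ [ Z u ]ᵇ) →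
    NodeBound Y v → NodeBound Z v → NodeBound X v
  node-bound-union X Y Z v split bY bZ =
    subst₂ (λ c w → ℕ→ℚ c ≤ λ′ * ℕ→ℚ w) (sym cuts) (sym weights) summed
    where
    summed : ℕ→ℚ (cutBetween G Y (single G v) ℕ.+ cutBetween G Z (single G v))
             ≤ λ′ * ℕ→ℚ (weight G var v ℕ.* W var Y ℕ.+ weight G var v ℕ.* W var Z)
    summed = scaled-+ λ′ (cutBetween G Y (single G v)) (weight G var v ℕ.* W var Y)
                         (cutBetween G Z (single G v)) (weight G var v ℕ.* W var Z) bY bZ
    cutsOf : ∀ A → cutBetween G A (single G v) ≡ mass A (edgesFrom (single G v))
    cutsOf A = trans (cut-sym A (single G v)) (cut-mass (single G v) A)
    cuts : cutBetween G X (single G v) ≡ cutBetween G Y (single G v) ℕ.+ cutBetween G Z (single G v)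
    cuts = trans (cutsOf X) (trans (mass-split X Y Z _ split) (sym (cong₂ ℕ._+_ (cutsOf Y) (cutsOf Z))))
    weights : weight G var v ℕ.* W var X ≡ weight G var v ℕ.* W var Y ℕ.+ weight G var v ℕ.* W var Z
    weights = trans (cong (weight G var v ℕ.*_) (mass-split X Y Z _ split)) (ℕP.*-distribˡ-+ (weight G var v) _ _)

∑ℚ-linear : ∀ {n} λ′ (f g : Fin n → ℚ) → ∑ℚ (λ i → f i - λ′ * g i) ≡ ∑ℚ f - λ′ * ∑ℚ g
∑ℚ-linear λ′ f g = begin
  ∑ℚ (λ i → f i - λ′ * g i)          ≡⟨ ∑ℚ-+ f (λ i → - (λ′ * g i)) ⟩
  ∑ℚ f + ∑ℚ (λ i → - (λ′ * g i))     ≡⟨ cong (∑ℚ f +_) (∑ℚ-cong (λ i → ℚP.neg-distribˡ-* λ′ (g i))) ⟩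
  ∑ℚ f + ∑ℚ (λ i → - λ′ * g i)       ≡⟨ cong (∑ℚ f +_) (∑ℚ-*ˡ (- λ′) g) ⟩
  ∑ℚ f + - λ′ * ∑ℚ g                 ≡⟨ cong (∑ℚ f +_) (ℚP.neg-distribˡ-* λ′ (∑ℚ g)) ⟨
  ∑ℚ f - λ′ * ∑ℚ g                   ∎
  where open ≡-Reasoning

when : Bool → ℚ → ℚ
when b x = if b then x else 0ℚ

when-0 : ∀ b → when b 0ℚ ≡ 0ℚ
when-0 true = refl
when-0 false = refl

when-+ : ∀ b x y → when b (x + y) ≡ when b x + when b y
when-+ true x y = refl
when-+ false x y = sym (ℚP.+-identityˡ 0ℚ)

_≺_ : ∀ {n} → Fin n → Fin n → Bool
i ≺ j = ⌊ toℕ i ℕ.<? toℕ j ⌋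

≺-halves : ∀ {n} (i j : Fin n) x → (i ≡ j → x ≡ 0ℚ) → when (i ≺ j) x + when (j ≺ i) x ≡ x
≺-halves i j x diagonal with ℕP.<-cmp (toℕ i) (toℕ j)
... | tri< i<j _ j≮i rewrite yes⇒true (toℕ i ℕ.<? toℕ j) i<j | no⇒false (toℕ j ℕ.<? toℕ i) j≮i =
  ℚP.+-identityʳ x
... | tri> i≮j _ j<i rewrite no⇒false (toℕ i ℕ.<? toℕ j) i≮j | yes⇒true (toℕ j ℕ.<? toℕ i) j<i =
  ℚP.+-identityˡ x
... | tri≈ i≮j i≡j j≮i rewrite no⇒false (toℕ i ℕ.<? toℕ j) i≮j | no⇒false (toℕ j ℕ.<? toℕ i) j≮i =
  trans (ℚP.+-identityˡ 0ℚ) (sym (diagonal (toℕ-injective i≡j)))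

∑-above-diagonal : ∀ {n} (X : Fin n → Fin n → ℚ) → (∀ i → X i i ≡ 0ℚ) →
  ∑ℚ (λ i → ∑ℚ (λ j → when (i ≺ j) (X i j + X j i))) ≡ ∑ℚ (λ i → ∑ℚ (X i))
∑-above-diagonal {n} X zero-diagonal = begin
  ∑ℚ (λ i → ∑ℚ (λ j → when (i ≺ j) (X i j + X j i)))
    ≡⟨ ∑ℚ-cong (λ i → trans (∑ℚ-cong (λ j → when-+ (i ≺ j) (X i j) (X j i))) (∑ℚ-+ (upper i) (λ j → when (i ≺ j) (X j i)))) ⟩
  ∑ℚ (λ i → ∑ℚ (upper i) + ∑ℚ (λ j → when (i ≺ j) (X j i)))
    ≡⟨ ∑ℚ-+ (λ i → ∑ℚ (upper i)) (λ i → ∑ℚ (λ j → when (i ≺ j) (X j i))) ⟩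
  ∑ℚ (λ i → ∑ℚ (upper i)) + ∑ℚ (λ i → ∑ℚ (λ j → when (i ≺ j) (X j i)))
    ≡⟨ cong (∑ℚ (λ i → ∑ℚ (upper i)) +_) (∑ℚ-comm (λ i j → when (i ≺ j) (X j i))) ⟩
  ∑ℚ (λ i → ∑ℚ (upper i)) + ∑ℚ (λ i → ∑ℚ (lower i))
    ≡⟨ ∑ℚ-+ (λ i → ∑ℚ (upper i)) (λ i → ∑ℚ (lower i)) ⟨
  ∑ℚ (λ i → ∑ℚ (upper i) + ∑ℚ (lower i))
    ≡⟨ ∑ℚ-cong (λ i → trans (sym (∑ℚ-+ (upper i) (lower i)))
         (∑ℚ-cong (λ j → ≺-halves i j (X i j) (λ { refl → zero-diagonal i })))) ⟩
  ∑ℚ (λ i → ∑ℚ (X i)) ∎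
  where
  open ≡-Reasoning
  upper lower : Fin n → Fin n → ℚ
  upper i j = when (i ≺ j) (X i j)
  lower i j = when (j ≺ i) (X i j)

module ObjectiveMerge {n : ℕ} (G : Graph n) (λ′ : ℚ) (var : Variant) where
  open Measures G

  w : Fin n → ℕ
  w = weight G var

  -- The objective's term for the pair (i, j), counted when i ≺ j, given
  -- whether i and j share a cluster; by definition objective c is
  -- Σ_i Σ_j pairCost i j (sameᵇ c i j).
  pairCost : Fin n → Fin n → Bool → ℚ
  pairCost i j together = when (i ≺ j)
    (if adj G i j then (if together then 0ℚ else 1ℚ - ww) else (if together then ww else 0ℚ))
    where ww = λ′ * ℕ→ℚ (w i ℕ.* w j)

  -- What the objective saves when i and j are put together.
  joinGain : Fin n → Fin n → ℚ
  joinGain i j = ℕ→ℚ [ adj G i j ]ᵇ - λ′ * ℕ→ℚ (w i ℕ.* w j)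

  joinGain-sym : ∀ i j → joinGain i j ≡ joinGain j i
  joinGain-sym i j rewrite Graph.sym G i j | ℕP.*-comm (w i) (w j) = refl

  joining : ∀ i j → pairCost i j false ≡ pairCost i j true + when (i ≺ j) (joinGain i j)
  joining i j with i ≺ j | adj G i j
  ... | false | _ = sym (ℚP.+-identityˡ 0ℚ)
  ... | true | true = sym (ℚP.+-identityˡ _)
  ... | true | false = sym (trans (cong (ww +_) (ℚP.+-identityˡ (- ww))) (ℚP.+-inverseʳ ww))
    where ww = λ′ * ℕ→ℚ (w i ℕ.* w j)

  crosses : VSet n → VSet n → Fin n → Fin n → Bool
  crosses A B i j = (A i ∧ B j) ∨ (B i ∧ A j)

  Disjoint : VSet n → VSet n → Set
  Disjoint A B = ∀ v → A v ∧ B v ≡ false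

  PairMerges : Clustering G → Clustering G → Fin n → Fin n → Bool → Set
  PairMerges c c′ i j crossing =
      (crossing ≡ true × sameᵇ G c i j ≡ false × sameᵇ G c′ i j ≡ true)
    ⊎ (crossing ≡ false × sameᵇ G c′ i j ≡ sameᵇ G c i j)

  Merges : Clustering G → Clustering G → VSet n → VSet n → Set
  Merges c c′ S T = ∀ i j → PairMerges c c′ i j (crosses S T i j)

  pair-change : ∀ c c′ S T i j → Merges c c′ S T →
    pairCost i j (sameᵇ G c i j) ≡ pairCost i j (sameᵇ G c′ i j) + when (i ≺ j) (when (crosses S T i j) (joinGain i j))
  pair-change c c′ S T i j merges with merges i j
  ... | inj₁ (crossing , apart , together) = begin
    pairCost i j (sameᵇ G c i j)                       ≡⟨ cong (pairCost i j) apart ⟩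
    pairCost i j false                                 ≡⟨ joining i j ⟩
    pairCost i j true + when (i ≺ j) (joinGain i j)    ≡⟨ cong₂ (λ s b → pairCost i j s + when (i ≺ j) (when b (joinGain i j)))
                                                                (sym together) (sym crossing) ⟩
    pairCost i j (sameᵇ G c′ i j) + when (i ≺ j) (when (crosses S T i j) (joinGain i j)) ∎
    where open ≡-Reasoning
  ... | inj₂ (not-crossing , unchanged) = begin
    pairCost i j (sameᵇ G c i j)                       ≡⟨ ℚP.+-identityʳ _ ⟨
    pairCost i j (sameᵇ G c i j) + 0ℚ                  ≡⟨ cong (pairCost i j (sameᵇ G c i j) +_) (when-0 (i ≺ j)) ⟨
    pairCost i j (sameᵇ G c i j) + when (i ≺ j) 0ℚ     ≡⟨ cong₂ (λ s b → pairCost i j s + when (i ≺ j) (when b (joinGain i j)))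
                                                                (sym unchanged) (sym not-crossing) ⟩
    pairCost i j (sameᵇ G c′ i j) + when (i ≺ j) (when (crosses S T i j) (joinGain i j)) ∎
    where open ≡-Reasoning

  crossing-orientations : ∀ a b c d (x y : ℚ) → x ≡ y → a ∧ b ≡ false → c ∧ d ≡ false →
    when ((a ∧ d) ∨ (b ∧ c)) x ≡ when (a ∧ d) x + when (c ∧ b) y
  crossing-orientations true true c d x y x≡y () c∧d
  crossing-orientations a b true true x y x≡y a∧b ()
  crossing-orientations true false true false x y x≡y a∧b c∧d = sym (ℚP.+-identityˡ 0ℚ)
  crossing-orientations true false false true x y x≡y a∧b c∧d = sym (ℚP.+-identityʳ x)
  crossing-orientations true false false false x y x≡y a∧b c∧d = sym (ℚP.+-identityˡ 0ℚ)
  crossing-orientations false true true false x y x≡y a∧b c∧d = trans x≡y (sym (ℚP.+-identityˡ y))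
  crossing-orientations false true false d x y x≡y a∧b c∧d = sym (ℚP.+-identityˡ 0ℚ)
  crossing-orientations false false true false x y x≡y a∧b c∧d = sym (ℚP.+-identityˡ 0ℚ)
  crossing-orientations false false false d x y x≡y a∧b c∧d = sym (ℚP.+-identityˡ 0ℚ)

  ∑-joinGain : ∀ S T → ∑ℚ (λ i → ∑ℚ (λ j → when (S i ∧ T j) (joinGain i j)))
                       ≡ ℕ→ℚ (cutBetween G S T) - λ′ * ℕ→ℚ (W var S ℕ.* W var T)
  ∑-joinGain S T = begin
    ∑ℚ (λ i → ∑ℚ (λ j → when (S i ∧ T j) (joinGain i j)))
      ≡⟨ ∑ℚ-cong (λ i → trans (∑ℚ-cong (λ j → termwise (S i) (T j)))
                              (∑ℚ-linear λ′ (λ j → ℕ→ℚ (edge i j)) (λ j → ℕ→ℚ (weights i j)))) ⟩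
    ∑ℚ (λ i → ∑ℚ (λ j → ℕ→ℚ (edge i j)) - λ′ * ∑ℚ (λ j → ℕ→ℚ (weights i j)))
      ≡⟨ ∑ℚ-linear λ′ (λ i → ∑ℚ (λ j → ℕ→ℚ (edge i j))) (λ i → ∑ℚ (λ j → ℕ→ℚ (weights i j))) ⟩
    ∑ℚ (λ i → ∑ℚ (λ j → ℕ→ℚ (edge i j))) - λ′ * ∑ℚ (λ i → ∑ℚ (λ j → ℕ→ℚ (weights i j)))
      ≡⟨ cong₂ (λ p q → p - λ′ * q) (sym (double-ℕ→ℚ edge)) (sym (double-ℕ→ℚ weights)) ⟩
    ℕ→ℚ (cutBetween G S T) - λ′ * ℕ→ℚ (∑ℕ (λ i → ∑ℕ (weights i)))
      ≡⟨ cong (λ p → ℕ→ℚ (cutBetween G S T) - λ′ * ℕ→ℚ p) weight-product ⟩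
    ℕ→ℚ (cutBetween G S T) - λ′ * ℕ→ℚ (W var S ℕ.* W var T) ∎
    where
    open ≡-Reasoning
    edge weights : Fin n → Fin n → ℕ
    edge i j = [ S i ∧ T j ∧ adj G i j ]ᵇ
    weights i j = [ S i ]ᵇ ℕ.* w i ℕ.* ([ T j ]ᵇ ℕ.* w j)
    termwise : ∀ {i j} s t → when (s ∧ t) (joinGain i j)
      ≡ ℕ→ℚ [ s ∧ t ∧ adj G i j ]ᵇ - λ′ * ℕ→ℚ ([ s ]ᵇ ℕ.* w i ℕ.* ([ t ]ᵇ ℕ.* w j))
    termwise {i} {j} true true = cong (λ x → ℕ→ℚ [ adj G i j ]ᵇ - λ′ * ℕ→ℚ x)
      (sym (cong₂ ℕ._*_ (ℕP.+-identityʳ (w i)) (ℕP.+-identityʳ (w j))))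
    termwise {i} true false = sym (cong (λ x → 0ℚ - x)
      (trans (cong (λ x → λ′ * ℕ→ℚ x) (ℕP.*-zeroʳ (w i ℕ.+ 0))) (ℚP.*-zeroʳ λ′)))
    termwise false t = sym (cong (λ x → 0ℚ - x) (ℚP.*-zeroʳ λ′))
    double-ℕ→ℚ : (f : Fin n → Fin n → ℕ) → ℕ→ℚ (∑ℕ (λ i → ∑ℕ (f i))) ≡ ∑ℚ (λ i → ∑ℚ (λ j → ℕ→ℚ (f i j)))
    double-ℕ→ℚ f = trans (ℕ→ℚ-∑ (λ i → ∑ℕ (f i))) (∑ℚ-cong (λ i → ℕ→ℚ-∑ (f i)))
    weight-product : ∑ℕ (λ i → ∑ℕ (weights i)) ≡ W var S ℕ.* W var T
    weight-product = trans (∑ℕ-cong (λ i → ∑ℕ-*ˡ ([ S i ]ᵇ ℕ.* w i) (λ j → [ T j ]ᵇ ℕ.* w j)))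
                           (∑ℕ-*ʳ (W var T) (λ i → [ S i ]ᵇ ℕ.* w i))

  objective-merge : ∀ c c′ S T → Disjoint S T → Merges c c′ S T →
    objective G λ′ var c ≡ objective G λ′ var c′ + (ℕ→ℚ (cutBetween G S T) - λ′ * ℕ→ℚ (W var S ℕ.* W var T))
  objective-merge c c′ S T disjoint merges = begin
    ∑ℚ (λ i → ∑ℚ (λ j → pairCost i j (sameᵇ G c i j)))
      ≡⟨ ∑ℚ-cong (λ i → trans (∑ℚ-cong (λ j → pair-change c c′ S T i j merges)) (∑ℚ-+ _ (crossingGain i))) ⟩
    ∑ℚ (λ i → ∑ℚ (λ j → pairCost i j (sameᵇ G c′ i j)) + ∑ℚ (crossingGain i))
      ≡⟨ ∑ℚ-+ (λ i → ∑ℚ (λ j → pairCost i j (sameᵇ G c′ i j))) (λ i → ∑ℚ (crossingGain i)) ⟩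
    objective G λ′ var c′ + ∑ℚ (λ i → ∑ℚ (crossingGain i))
      ≡⟨ cong (objective G λ′ var c′ +_) (∑ℚ-cong (λ i → ∑ℚ-cong (λ j → cong (when (i ≺ j)) (orientations i j)))) ⟩
    objective G λ′ var c′ + ∑ℚ (λ i → ∑ℚ (λ j → when (i ≺ j) (ST i j + ST j i)))
      ≡⟨ cong (objective G λ′ var c′ +_) (∑-above-diagonal ST (λ i → cong (λ b → when b (joinGain i i)) (disjoint i))) ⟩
    objective G λ′ var c′ + ∑ℚ (λ i → ∑ℚ (ST i))
      ≡⟨ cong (objective G λ′ var c′ +_) (∑-joinGain S T) ⟩
    objective G λ′ var c′ + (ℕ→ℚ (cutBetween G S T) - λ′ * ℕ→ℚ (W var S ℕ.* W var T)) ∎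
    where
    open ≡-Reasoning
    crossingGain ST : Fin n → Fin n → ℚ
    crossingGain i j = when (i ≺ j) (when (crosses S T i j) (joinGain i j))
    ST i j = when (S i ∧ T j) (joinGain i j)
    orientations : ∀ i j → when (crosses S T i j) (joinGain i j) ≡ ST i j + ST j i
    orientations i j = crossing-orientations (S i) (T i) (S j) (T j) _ _ (joinGain-sym i j) (disjoint i) (disjoint j)

  -- Where node v sits when cluster a of c (the set S) is merged into the
  -- cluster k (the set T), giving c′: members of S and T end up in k and
  -- every other node keeps its cluster.
  data Position (c c′ : Clustering G) (a k v : Fin n) : Bool → Bool → Set where
    inS     : c v ≡ a → c′ v ≡ k → Position c c′ a k v true false
    inT     : c v ≡ k → c′ v ≡ k → Position c c′ a k v false true
    outside : ¬ c v ≡ a → ¬ c v ≡ k → c′ v ≡ c v → Position c c′ a k v false false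

  positions-disjoint : ∀ {c c′ a k} S T → (∀ v → Position c c′ a k v (S v) (T v)) → Disjoint S T
  positions-disjoint S T position v with S v | T v | position v
  ... | _ | _ | inS _ _ = refl
  ... | _ | _ | inT _ _ = refl
  ... | _ | _ | outside _ _ _ = refl

  same-cong : ∀ c c′ i j → (c′ i ≡ c′ j → c i ≡ c j) → (c i ≡ c j → c′ i ≡ c′ j) →
    sameᵇ G c′ i j ≡ sameᵇ G c i j
  same-cong c c′ i j = ≟-cong {a = c′ i} {c′ j} {c i} {c j}

  positions-pair : ∀ {c c′ a k i j si ti sj tj} → ¬ a ≡ k →
    Position c c′ a k i si ti → Position c c′ a k j sj tj → PairMerges c c′ i j ((si ∧ tj) ∨ (ti ∧ sj))
  positions-pair {c} {c′} {i = i} {j} a≢k (inS ci ci′) (inS cj cj′) =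
    inj₂ (refl , same-cong c c′ i j (λ _ → trans ci (sym cj)) (λ _ → trans ci′ (sym cj′)))
  positions-pair {c} {c′} {i = i} {j} a≢k (inS ci ci′) (inT cj cj′) =
    inj₁ (refl , no⇒false (c i ≟ c j) (λ e → a≢k (trans (sym ci) (trans e cj))) ,
          yes⇒true (c′ i ≟ c′ j) (trans ci′ (sym cj′)))
  positions-pair {c} {c′} {i = i} {j} a≢k (inS ci ci′) (outside cj≢a cj≢k cj′) =
    inj₂ (refl , same-cong c c′ i j (λ e → ⊥-elim (cj≢k (trans (sym cj′) (trans (sym e) ci′))))
                                    (λ e → ⊥-elim (cj≢a (trans (sym e) ci))))
  positions-pair {c} {c′} {i = i} {j} a≢k (inT ci ci′) (inS cj cj′) =
    inj₁ (refl , no⇒false (c i ≟ c j) (λ e → a≢k (trans (sym cj) (trans (sym e) ci))) ,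
          yes⇒true (c′ i ≟ c′ j) (trans ci′ (sym cj′)))
  positions-pair {c} {c′} {i = i} {j} a≢k (inT ci ci′) (inT cj cj′) =
    inj₂ (refl , same-cong c c′ i j (λ _ → trans ci (sym cj)) (λ _ → trans ci′ (sym cj′)))
  positions-pair {c} {c′} {i = i} {j} a≢k (inT ci ci′) (outside cj≢a cj≢k cj′) =
    inj₂ (refl , same-cong c c′ i j (λ e → ⊥-elim (cj≢k (trans (sym cj′) (trans (sym e) ci′))))
                                    (λ e → ⊥-elim (cj≢k (trans (sym e) ci))))
  positions-pair {c} {c′} {i = i} {j} a≢k (outside ci≢a ci≢k ci′) (inS cj cj′) =
    inj₂ (refl , same-cong c c′ i j (λ e → ⊥-elim (ci≢k (trans (sym ci′) (trans e cj′))))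
                                    (λ e → ⊥-elim (ci≢a (trans e cj))))
  positions-pair {c} {c′} {i = i} {j} a≢k (outside ci≢a ci≢k ci′) (inT cj cj′) =
    inj₂ (refl , same-cong c c′ i j (λ e → ⊥-elim (ci≢k (trans (sym ci′) (trans e cj′))))
                                    (λ e → ⊥-elim (ci≢k (trans e cj))))
  positions-pair {c} {c′} {i = i} {j} a≢k (outside _ _ ci′) (outside _ _ cj′) =
    inj₂ (refl , same-cong c c′ i j (λ e → trans (sym ci′) (trans e cj′))
                                    (λ e → trans ci′ (trans e (sym cj′))))

  positions-merge : ∀ {c c′ a k} S T → ¬ a ≡ k → (∀ v → Position c c′ a k v (S v) (T v)) → Merges c c′ S T
  positions-merge S T a≢k position i j = positions-pair a≢k (position i) (position j)

module LambdaLouvain {n : ℕ} (G : Graph n) (λ′ : ℚ) (0≤λ′ : 0ℚ ≤ λ′) (var : Variant) where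
  open Measures G
  open CutBounds G λ′ var
  open ObjectiveMerge G λ′ var

  -- Invariant of a run: every super-node lies inside a single cluster.
  Refines : LState G → Set
  Refines s = ∀ u v → P s u ≡ P s v → C s u ≡ C s v

  module Stopped (s : LState G) (stable : Stable G λ′ var s) (same : SamePartition G s)
                 (refines : Refines s) (u : Fin n) where

    a : Fin n
    a = C s u

    S : VSet n
    S = clusterOf G (C s) u

    -- S̄ is partitioned into the pieces: cluster k minus S, for every label k.
    piece : Fin n → VSet n
    piece k v = ⌊ k ≟ C s v ⌋ ∧ not (S v)

    partition : ∀ v → ∑ℕ (λ k → [ piece k v ]ᵇ) ≡ [ not (S v) ]ᵇ
    partition v = trans (∑ℕ-cong (λ k → indicator ⌊ k ≟ C s v ⌋ (not (S v))))
                        (∑ℕ-delta (C s v) (λ _ → [ not (S v) ]ᵇ))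
      where
      indicator : ∀ b t → [ b ∧ t ]ᵇ ≡ [ b ]ᵇ ℕ.* [ t ]ᵇ
      indicator true t = sym (ℕP.+-identityʳ [ t ]ᵇ)
      indicator false t = refl

    -- Moving the super-node of u into cluster k moves exactly the cluster S,
    -- since clusters are super-nodes.
    moved : Fin n → Clustering G
    moved k = moveTo G s (P s u) k

    gathered : ∀ k v → a ≡ C s v → moved k v ≡ k
    gathered k v a≡v = cong (λ b → if b then k else C s v)
                            (yes⇒true (P s v ≟ P s u) (sym (same u v a≡v)))

    stays : ∀ k v → ¬ a ≡ C s v → moved k v ≡ C s v
    stays k v a≢v = cong (λ b → if b then k else C s v)
                         (no⇒false (P s v ≟ P s u) (λ p → a≢v (sym (refines v u p))))

    position : ∀ k → ¬ k ≡ a → ∀ v → Position (C s) (moved k) a k v (S v) (piece k v)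
    position k k≢a v with a ≟ C s v | k ≟ C s v
    ... | yes a≡v | yes k≡v = contradiction (trans k≡v (sym a≡v)) k≢a
    ... | yes a≡v | no _ = inS (sym a≡v) (gathered k v a≡v)
    ... | no a≢v | yes k≡v = inT (sym k≡v) (trans (stays k v a≢v) (sym k≡v))
    ... | no a≢v | no k≢v = outside (a≢v ∘ sym) (k≢v ∘ sym) (stays k v a≢v)

    -- A violated piece bound makes merging S into cluster k an improving
    -- move to an adjacent cluster, which stability forbids.
    no-violation : ∀ k → ¬ ¬ PieceBound S (piece k)
    no-violation k violated = stable (P s u) k adjacent improving
      where
      nonzero : ¬ cutBetween G S (piece k) ≡ 0
      nonzero cut≡0 = violated (subst (λ x → ℕ→ℚ x ≤ λ′ * ℕ→ℚ (W var S ℕ.* W var (piece k)))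
                                     (sym cut≡0) (scaled-nonNeg 0≤λ′ (W var S ℕ.* W var (piece k))))
      edge : ∃[ x ] ∃[ y ] (S x ≡ true × piece k y ≡ true × adj G x y ≡ true)
      edge = cut-witness S (piece k) nonzero
      x y : Fin n
      x = proj₁ edge
      y = proj₁ (proj₂ edge)
      a≡x : a ≡ C s x
      a≡x = true⇒yes (a ≟ C s x) (proj₁ (proj₂ (proj₂ edge)))
      y∈piece : piece k y ≡ true
      y∈piece = proj₁ (proj₂ (proj₂ (proj₂ edge)))
      k≡y : k ≡ C s y
      k≡y = true⇒yes (k ≟ C s y) (∧-conicalˡ ⌊ k ≟ C s y ⌋ (not (S y)) y∈piece)
      a≢k : ¬ a ≡ k
      a≢k a≡k = false⇒no (a ≟ C s y) (not-injective {S y} {false} (∧-conicalʳ ⌊ k ≟ C s y ⌋ (not (S y)) y∈piece))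
                         (trans a≡k k≡y)
      adjacent : AdjTarget G s (P s u) k
      adjacent = x , y , sym (same u x a≡x) , sym k≡y , (λ x≡k → a≢k (trans a≡x x≡k)) ,
                 proj₂ (proj₂ (proj₂ (proj₂ edge)))
      saving : ℚ
      saving = ℕ→ℚ (cutBetween G S (piece k)) - λ′ * ℕ→ℚ (W var S ℕ.* W var (piece k))
      merge-saving : objective G λ′ var (C s) ≡ objective G λ′ var (moved k) + saving
      merge-saving = objective-merge (C s) (moved k) S (piece k)
        (positions-disjoint S (piece k) (position k (a≢k ∘ sym)))
        (positions-merge S (piece k) a≢k (position k (a≢k ∘ sym)))
      improving : Improving G λ′ var s (P s u) k
      improving = subst (objective G λ′ var (moved k) <_) (sym merge-saving)
        (subst (_< objective G λ′ var (moved k) + saving) (ℚP.+-identityʳ (objective G λ′ var (moved k)))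
               (ℚP.+-monoʳ-< (objective G λ′ var (moved k)) (sub-pos (ℚP.≰⇒> violated))))

    piece-bound : ∀ k → PieceBound S (piece k)
    piece-bound k = decidable-stable (ℕ→ℚ (cutBetween G S (piece k)) ℚP.≤? λ′ * ℕ→ℚ (W var S ℕ.* W var (piece k)))
                                     (no-violation k)

    cluster-bound : ClusterBound S
    cluster-bound = bound-from-partition S piece partition piece-bound

  move-refines : ∀ s b ℓ → Refines s → Refines (lstate (P s) (moveTo G s b ℓ))
  move-refines s b ℓ refines u v pu≡pv rewrite pu≡pv with ⌊ P s v ≟ b ⌋
  ... | true = refl
  ... | false = refines u v pu≡pv

  -- The invariant holds throughout a run (aggregation makes super-nodes
  -- equal to clusters), so the clusters of the final state are bounded.
  run-bound : ∀ {s c} → LRun G λ′ var s c → Refines s → ∀ u → ClusterBound (clusterOf G c u)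
  run-bound {s} (step (move b ℓ _ _ _) run) refines = run-bound run (move-refines s b ℓ refines)
  run-bound (aggregate _ _ run) _ = run-bound run (λ u v e → e)
  run-bound {s} (stop stable same) refines = Stopped.cluster-bound s stable same refines

nonpositive-gain : ∀ {n} (G : Graph n) λ′ var S v → gain G λ′ var S v ≤ 0ℚ →
  CutBounds.NodeBound G λ′ var S v
nonpositive-gain G λ′ standard S v Δ≤0 =
  subst (λ x → ℕ→ℚ (cutBetween G S (single G v)) ≤ λ′ * ℕ→ℚ x)
        (trans (Measures.size-W G S) (sym (ℕP.+-identityʳ (Measures.W G standard S)))) (sub-nonpos Δ≤0)
nonpositive-gain G λ′ degreeWeighted S v Δ≤0 =
  subst (λ x → ℕ→ℚ (cutBetween G S (single G v)) ≤ λ′ * ℕ→ℚ (deg G v ℕ.* x))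
        (Measures.vol-W G S) (sub-nonpos Δ≤0)

module GrowCluster {n : ℕ} (G : Graph n) (λ′ : ℚ) (var : Variant) where
  open Measures G
  open CutBounds G λ′ var

  _⊆_ : VSet n → VSet n → Set
  A ⊆ B = ∀ x → A x ≡ true → B x ≡ true

  grow-end : ∀ {U S₀ S} → Grow G λ′ var U S₀ S → S₀ ⊆ U →
    S ⊆ U × (∀ v → Cand G U S v → gain G λ′ var S v ≤ 0ℚ)
  grow-end {U} {S₀} (add v (v∈U , _) _ _ grow) S₀⊆U = grow-end grow inserted⊆U
    where
    inserted⊆U : insert G v S₀ ⊆ U
    inserted⊆U x x∈ with S₀ x in x∈S₀ | x ≟ v
    ... | true | _ = S₀⊆U x x∈S₀
    ... | false | yes refl = v∈U
  grow-end (done final) S₀⊆U = S₀⊆U , final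

  -- Invariant: each unclustered node satisfies the node bound against the
  -- set Ū of already clustered nodes.
  Settled : VSet n → Set
  Settled U = ∀ x → U x ≡ true → NodeBound (compl G U) x

  settled-start : Settled (λ _ → true)
  settled-start x _ = subst₂ (λ c w → ℕ→ℚ c ≤ λ′ * ℕ→ℚ w) (sym no-edges) (sym no-weight)
                             (ℚP.≤-reflexive (sym (ℚP.*-zeroʳ λ′)))
    where
    no-edges : cutBetween G (λ _ → false) (single G x) ≡ 0
    no-edges = trans (∑ℕ-cong {n} (λ _ → ∑ℕ-zero n)) (∑ℕ-zero n)
    no-weight : weight G var x ℕ.* W var (λ _ → false) ≡ 0
    no-weight = trans (cong (weight G var x ℕ.*_) (∑ℕ-zero n)) (ℕP.*-zeroʳ (weight G var x))

  -- Each output cluster S is bounded against Ū (by the invariant) and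
  -- against U ∖ S (by the stopping rule); the invariant then persists.
  output-bound : ∀ {U cs} → GC G λ′ var U cs → Settled U → All ClusterBound cs
  output-bound (finish _) _ = []
  output-bound {U} (next {S = S} u u∈U grow rest) settled =
    bound-from-partition S parts partition part-bound ∷ output-bound rest settled′
    where
    ends : S ⊆ U × (∀ v → Cand G U S v → gain G λ′ var S v ≤ 0ℚ)
    ends = grow-end grow (λ x x∈single → subst (λ y → U y ≡ true) (sym (true⇒yes (x ≟ u) x∈single)) u∈U)
    S⊆U : S ⊆ U
    S⊆U = proj₁ ends
    stopped : ∀ v → U v ≡ true → S v ≡ false → NodeBound S v
    stopped v v∈U v∉S = nonpositive-gain G λ′ var S v (proj₂ ends v (v∈U , v∉S))

    -- S̄ consists of the earlier clusters Ū and the rest U ∖ S of U.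
    parts : Fin 2 → VSet n
    parts zero = compl G U
    parts (suc zero) = minus G U S

    split : ∀ v → [ compl G (minus G U S) v ]ᵇ ≡ [ compl G U v ]ᵇ ℕ.+ [ S v ]ᵇ
    split v with U v in U-v | S v in S-v
    ... | true | true = refl
    ... | true | false = refl
    ... | false | false = refl
    ... | false | true = contradiction (trans (sym U-v) (S⊆U v S-v)) λ ()

    partition : ∀ v → ∑ℕ (λ k → [ parts k v ]ᵇ) ≡ [ not (S v) ]ᵇ
    partition v with U v in U-v | S v in S-v
    ... | true | true = refl
    ... | true | false = refl
    ... | false | false = refl
    ... | false | true = contradiction (trans (sym U-v) (S⊆U v S-v)) λ ()

    part-bound : ∀ k → PieceBound S (parts k)
    part-bound zero = piece-sym (compl G U) S
      (bound-from-nodes (compl G U) S (λ v v∈S → settled v (S⊆U v v∈S)))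
    part-bound (suc zero) = bound-from-nodes S (minus G U S)
      (λ v v∈rest → stopped v (∧-conicalˡ (U v) (not (S v)) v∈rest)
                              (not-injective {S v} {false} (∧-conicalʳ (U v) (not (S v)) v∈rest)))

    settled′ : Settled (minus G U S)
    settled′ x x∈rest = node-bound-union (compl G (minus G U S)) (compl G U) S x split
      (settled x x∈U) (stopped x x∈U x∉S)
      where
      x∈U : U x ≡ true
      x∈U = ∧-conicalˡ (U x) (not (S x)) x∈rest
      x∉S : S x ≡ false
      x∉S = not-injective {S x} {false} (∧-conicalʳ (U x) (not (S x)) x∈rest)

theorem9 : ∀ {n} (G : Graph n) (λ′ : ℚ) → 0ℚ < λ′ → λ′ < 1ℚ → (var : Variant) →
    (∀ c → LambdaLouvainOutput G λ′ var c →
       (∀ u v → c u ≡ c v) ⊎ (∀ u → ScaledCutBound G λ′ var (clusterOf G c u)))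
    × (∀ cs → GrowClusterOutput G λ′ var cs →
       Any (λ S → ∀ v → S v ≡ true) cs ⊎ All (ScaledCutBound G λ′ var) cs)
theorem9 G λ′ 0<λ′ _ var = louvain , grow-cluster
  where
  louvain : ∀ c → LambdaLouvainOutput G λ′ var c →
    (∀ u v → c u ≡ c v) ⊎ (∀ u → ScaledCutBound G λ′ var (clusterOf G c u))
  louvain c run = inj₂ λ u → scaled-cut-bound G λ′ var (clusterOf G c u)
    (LambdaLouvain.run-bound G λ′ (ℚP.<⇒≤ 0<λ′) var run (λ _ _ same-super-node → same-super-node) u)
  grow-cluster : ∀ cs → GrowClusterOutput G λ′ var cs →
    Any (λ S → ∀ v → S v ≡ true) cs ⊎ All (ScaledCutBound G λ′ var) cs
  grow-cluster cs run = inj₂ (All.map (λ {S} → scaled-cut-bound G λ′ var S)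
    (output-bound run settled-start))
    where open GrowCluster G λ′ var
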